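{- Let $r\geq 2$ and let $m,a$ be integers with $1<m<a$. Define $\mathcal{E}=(e_1,\ldots,e_{3r})$ by $e_1=1$, $e_2=a$, $e_k=e_{k-1}+a-1$ if $k$ is odd and $3\leq k\leq 2r+1$, $e_k=e_{k-1}+(m-1)(2a-1)-(a-1)$ if $k$ is even and $3<k<2r+1$, and $e_k=e_{k-1}+(m-1)(2a-1)$ if $2r+1<k\leq 3r$. Then $\mathcal{E}$ has pattern $(+++-\cdots-+)$, i.e., its prefix coin systems of lengths $1,2,3$ are orderly, its prefix coin systems of lengths $4,\ldots,3r-1$ are not orderly, and $\mathcal{E}$ itself is orderly.
   Context: A coin system is a tuple $(c_1,\ldots,c_n)$ of integers with $c_1=1<c_2<\cdots<c_n$; each coin value may be used any number of times. For a positive integer $v$, $opt(v)$ is the minimum number of coins summing to $v$, and $grd(v)$ is the number of coins used by the greedy algorithm (repeatedly take as many coins as possible of the largest coin value not exceeding the remaining amount). A coin system is orderly if $grd(v)=opt(v)$ for all $v>0$. The prefix coin system of length $i$ is $(c_1,\ldots,c_i)$; the pattern of a coin system is the string whose $i$-th symbol is $+$ if the prefix of length $i$ is orderly and $-$ otherwise. -}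

module Defs where

open import Data.Nat using (ℕ; zero; suc; _+_; _*_; _∸_; _≤_; _<_; _≤?_; _<?_; _≟_)
open import Data.Nat.DivMod using (_/_; _%_)
open import Data.List using (List; []; _∷_; reverse; length; applyUpTo)
open import Data.Nat.ListAction using (sum)
open import Data.List.Relation.Unary.All using (All)
open import Data.List.Membership.Propositional using (_∈_)
open import Data.Product using (Σ; _×_; _,_)
open import Data.Bool using (if_then_else_)
open import Relation.Nullary.Decidable using (⌊_⌋)
open import Relation.Binary.PropositionalEquality using (_≡_)

-- A coin system is represented by the list (c₁ , … , cₙ) in increasing order.
CoinSystem : Set
CoinSystem = List ℕ

Representation : CoinSystem → ℕ → Set
Representation cs v = Σ (List ℕ) λ xs → All (_∈ cs) xs × sum xs ≡ v

IsOpt : CoinSystem → ℕ → ℕ → Set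
IsOpt cs v k =
  Σ (Representation cs v) (λ r → length (Data.Product.proj₁ r) ≡ k)
  × ((r : Representation cs v) → k ≤ length (Data.Product.proj₁ r))

grdDesc : List ℕ → ℕ → ℕ
grdDesc [] v = 0
grdDesc (zero ∷ cs) v = grdDesc cs v
grdDesc (suc c ∷ cs) v = v / suc c + grdDesc cs (v % suc c)

grd : CoinSystem → ℕ → ℕ
grd cs v = grdDesc (reverse cs) v

Orderly : CoinSystem → Set
Orderly cs = (v : ℕ) → 0 < v → IsOpt cs v (grd cs v)

prefix : CoinSystem → ℕ → CoinSystem
prefix cs i = Data.List.take i cs

-- The sequence E (1-indexed): eE r m a k = e_k, for 1 ≤ k ≤ 3r.
-- Step from e_{k-1} to e_k for k ≥ 3:
--   k odd,  3 ≤ k ≤ 2r+1 : + (a-1)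
--   k even, 3 < k < 2r+1 : + (m-1)(2a-1) - (a-1)   (nonnegative since m ≥ 2)
--   2r+1 < k ≤ 3r        : + (m-1)(2a-1)
eStep : ℕ → ℕ → ℕ → ℕ → ℕ → ℕ
eStep r m a k prev =
  if ⌊ k ≤? 2 * r + 1 ⌋
  then (if ⌊ k % 2 ≟ 1 ⌋
        then prev + (a ∸ 1)
        else prev + (m ∸ 1) * (2 * a ∸ 1) ∸ (a ∸ 1))
  else prev + (m ∸ 1) * (2 * a ∸ 1)

eE : ℕ → ℕ → ℕ → ℕ → ℕ
eE r m a zero = 0
eE r m a (suc zero) = 1
eE r m a (suc (suc zero)) = a
eE r m a (suc (suc (suc k))) = eStep r m a (3 + k) (eE r m a (suc (suc k)))

coinE : ℕ → ℕ → ℕ → CoinSystem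
coinE r m a = applyUpTo (λ j → eE r m a (suc j)) (3 * r)

-- The coins of E are 1, P j = jX + a (j ≤ R) and B k = kX + b (k ≤ 2R), where
-- b = 2a − 1 and X = (m − 1)b.  Below T = B (2R) greedy uses at most one coin
-- above b, followed by b's, a's and 1's; such residues plus multiples of T are
-- forms on which greedy is computed in closed form.  Adding any coin to a form
-- yields a form with at most one more coin, the carries being (m − 1)b = X,
-- (a − 1) + P j = B j, and B j + B k or B k + P j reaching T; by induction on a
-- representation greedy is then optimal.  The prefixes (1), (1, a), (1, a, b)
-- are orderly in the same way, whereas in every longer proper prefix the
-- largest coin, P j or B k, lures greedy away from a cheaper representation.
module Submission where

open import Defs
open import Data.Nat
open import Data.Nat.Properties
open import Data.Nat.DivMod
open import Data.Nat.ListAction using (sum)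
open import Data.Nat.ListAction.Properties using (sum-++)
open import Data.Nat.Tactic.RingSolver using (solve-∀)
open import Algebra.Properties.CommutativeSemigroup +-commutativeSemigroup using (x∙yz≈y∙xz)
open import Data.List using (List; []; _∷_; _++_; replicate; reverse; length; take; applyUpTo; applyDownFrom)
open import Data.List.Properties using (length-++; length-replicate; reverse-applyUpTo)
open import Data.List.Relation.Unary.All as All using (All; []; _∷_)
open import Data.List.Relation.Unary.All.Properties using (++⁺; replicate⁺)
open import Data.List.Relation.Unary.Any using (here; there)
open import Data.List.Relation.Unary.Any.Properties using (reverse⁺; reverse⁻)
open import Data.List.Membership.Propositional using (_∈_)
open import Data.List.Membership.Propositional.Properties using (∈-applyUpTo⁺; ∈-applyUpTo⁻)
open import Data.Product using (Σ; _×_; _,_; proj₁; proj₂)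
open import Data.Sum using (_⊎_; inj₁; inj₂)
open import Data.Unit using (⊤; tt)
open import Relation.Nullary using (¬_; yes; no; contradiction)
open import Relation.Binary.PropositionalEquality
open import Function using (_∘′_)

sum-replicate : ∀ k c → sum (replicate k c) ≡ k * c
sum-replicate zero    c = refl
sum-replicate (suc k) c = cong (c +_) (sum-replicate k c)

take-applyUpTo : ∀ (f : ℕ → ℕ) {i n} → i ≤ n → take i (applyUpTo f n) ≡ applyUpTo f i
take-applyUpTo f {zero}  _         = refl
take-applyUpTo f {suc i} (s≤s i≤n) = cong (f 0 ∷_) (take-applyUpTo (f ∘′ suc) i≤n)

greedy : List ℕ → ℕ → List ℕ
greedy []           v = []
greedy (zero ∷ cs)  v = greedy cs v
greedy (suc c ∷ cs) v = replicate (v / suc c) (suc c) ++ greedy cs (v % suc c)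

greedyRest : List ℕ → ℕ → ℕ
greedyRest []           v = v
greedyRest (zero ∷ cs)  v = greedyRest cs v
greedyRest (suc c ∷ cs) v = greedyRest cs (v % suc c)

length-greedy : ∀ cs v → length (greedy cs v) ≡ grdDesc cs v
length-greedy []           v = refl
length-greedy (zero ∷ cs)  v = length-greedy cs v
length-greedy (suc c ∷ cs) v = trans (length-++ (replicate (v / suc c) (suc c)))
  (cong₂ _+_ (length-replicate (v / suc c)) (length-greedy cs (v % suc c)))

sum-greedy+greedyRest : ∀ cs v → sum (greedy cs v) + greedyRest cs v ≡ v
sum-greedy+greedyRest []           v = refl
sum-greedy+greedyRest (zero ∷ cs)  v = sum-greedy+greedyRest cs v
sum-greedy+greedyRest (suc c ∷ cs) v = begin
  sum (replicate q (suc c) ++ greedy cs w) + greedyRest cs w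
    ≡⟨ cong (_+ greedyRest cs w) (sum-++ (replicate q (suc c)) (greedy cs w)) ⟩
  sum (replicate q (suc c)) + sum (greedy cs w) + greedyRest cs w
    ≡⟨ +-assoc (sum (replicate q (suc c))) _ _ ⟩
  sum (replicate q (suc c)) + (sum (greedy cs w) + greedyRest cs w)
    ≡⟨ cong₂ _+_ (sum-replicate q (suc c)) (sum-greedy+greedyRest cs w) ⟩
  q * suc c + w
    ≡⟨ +-comm (q * suc c) w ⟩
  w + q * suc c
    ≡⟨ m≡m%n+[m/n]*n v (suc c) ⟨
  v ∎
  where
  open ≡-Reasoning
  q = v / suc c
  w = v % suc c

greedyRest-zero : ∀ cs → greedyRest cs 0 ≡ 0
greedyRest-zero []           = refl
greedyRest-zero (zero ∷ cs)  = greedyRest-zero cs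
greedyRest-zero (suc c ∷ cs) = greedyRest-zero cs

greedyRest≡0 : ∀ cs v → 1 ∈ cs → greedyRest cs v ≡ 0
greedyRest≡0 (.1 ∷ cs)    v (here refl) = trans (cong (greedyRest cs) (n%1≡0 v)) (greedyRest-zero cs)
greedyRest≡0 (zero ∷ cs)  v (there 1∈) = greedyRest≡0 cs v 1∈
greedyRest≡0 (suc c ∷ cs) v (there 1∈) = greedyRest≡0 cs (v % suc c) 1∈

greedy⊆ : ∀ cs v → All (_∈ cs) (greedy cs v)
greedy⊆ []           v = []
greedy⊆ (zero ∷ cs)  v = All.map there (greedy⊆ cs v)
greedy⊆ (suc c ∷ cs) v =
  ++⁺ (replicate⁺ (v / suc c) (here refl)) (All.map there (greedy⊆ cs (v % suc c)))

greedyRepresentation : ∀ cs v → 1 ∈ cs →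
  Σ (Representation cs v) λ ρ → length (proj₁ ρ) ≡ grd cs v
greedyRepresentation cs v 1∈cs =
  (greedy (reverse cs) v , All.map reverse⁻ (greedy⊆ (reverse cs) v) , sums-to-v) ,
  length-greedy (reverse cs) v
  where
  sums-to-v : sum (greedy (reverse cs) v) ≡ v
  sums-to-v = begin
    sum gs                                ≡⟨ +-identityʳ _ ⟨
    sum gs + 0                            ≡⟨ cong (sum gs +_) (greedyRest≡0 (reverse cs) v (reverse⁺ 1∈cs)) ⟨
    sum gs + greedyRest (reverse cs) v    ≡⟨ sum-greedy+greedyRest (reverse cs) v ⟩
    v ∎
    where
    open ≡-Reasoning
    gs = greedy (reverse cs) v

grdDesc-below : ∀ c cs {w} → w < c → grdDesc (c ∷ cs) w ≡ grdDesc cs w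
grdDesc-below (suc c) cs w<c = cong₂ _+_ (m<n⇒m/n≡0 w<c) (cong (grdDesc cs) (m<n⇒m%n≡m w<c))

grdDesc-+* : ∀ c cs q {w} → w < c → grdDesc (c ∷ cs) (w + q * c) ≡ q + grdDesc cs w
grdDesc-+* (suc c) cs q {w} w<c = cong₂ _+_ quotient (cong (grdDesc cs) remainder)
  where
  remainder : (w + q * suc c) % suc c ≡ w
  remainder = trans ([m+kn]%n≡m%n w q (suc c)) (m<n⇒m%n≡m w<c)
  quotient : (w + q * suc c) / suc c ≡ q
  quotient = begin
    (w + q * suc c) / suc c
      ≡⟨ +-distrib-/ w (q * suc c) remainders<c ⟩
    w / suc c + q * suc c / suc c
      ≡⟨ cong₂ _+_ (m<n⇒m/n≡0 w<c) (m*n/n≡m q (suc c)) ⟩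
    q ∎
    where
    open ≡-Reasoning
    remainders<c : w % suc c + q * suc c % suc c < suc c
    remainders<c = subst (_< suc c)
      (sym (trans (cong (w % suc c +_) (m*n%n≡0 q (suc c))) (+-identityʳ _))) (m%n<n w (suc c))

Attains : {F : Set} → (F → ℕ) → (F → ℕ) → ℕ → ℕ → Set
Attains {F} value cost v c = Σ F λ f → value f ≡ v × cost f ≤ c

attains-cast : ∀ {F : Set} {value cost : F → ℕ} {v v′ c c′} →
  v ≡ v′ → c ≤ c′ → Attains value cost v c → Attains value cost v′ c′
attains-cast v≡v′ c≤c′ (f , value≡v , cost≤c) = f , trans value≡v v≡v′ , ≤-trans cost≤c c≤c′

-- Greedy is computed exactly on forms; if adding any coin to a form costs at
-- most one more coin, induction on a representation bounds grd by its length.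
record GreedyForms (cs : CoinSystem) : Set₁ where
  field
    Form        : Set
    value cost  : Form → ℕ
    empty       : Form
    value-empty : value empty ≡ 0
    cost-empty  : cost empty ≡ 0
    grd-value   : ∀ f → grd cs (value f) ≡ cost f
    add-coin    : ∀ f {c} → c ∈ cs → Attains value cost (c + value f) (suc (cost f))

module _ {cs : CoinSystem} (G : GreedyForms cs) where
  open GreedyForms G

  representation-form : ∀ xs → All (_∈ cs) xs → Attains value cost (sum xs) (length xs)
  representation-form []       []         = empty , value-empty , ≤-reflexive cost-empty
  representation-form (x ∷ xs) (x∈ ∷ xs⊆) with representation-form xs xs⊆
  ... | f , value≡ , cost≤ with add-coin f x∈
  ... | f′ , value≡′ , cost≤′ = f′ , trans value≡′ (cong (x +_) value≡) , ≤-trans cost≤′ (s≤s cost≤)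

  forms⇒orderly : 1 ∈ cs → Orderly cs
  forms⇒orderly 1∈cs v _ = greedyRepresentation cs v 1∈cs , λ (xs , xs⊆ , sum≡v) → grd≤ xs xs⊆ sum≡v
    where
    grd≤ : ∀ xs → All (_∈ cs) xs → sum xs ≡ v → grd cs v ≤ length xs
    grd≤ xs xs⊆ refl with representation-form xs xs⊆
    ... | f , value≡ , cost≤ =
      subst (λ w → grd cs w ≤ length xs) value≡ (subst (_≤ length xs) (sym (grd-value f)) cost≤)

shorter⇒¬orderly : ∀ {cs v} → 0 < v → (xs : List ℕ) → All (_∈ cs) xs → sum xs ≡ v →
  length xs < grd cs v → ¬ Orderly cs
shorter⇒¬orderly 0<v xs xs⊆ sum≡v shorter orderly =
  <⇒≱ shorter (proj₂ (orderly _ 0<v) (xs , xs⊆ , sum≡v))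

grdDesc-units : ∀ v → grdDesc (1 ∷ []) v ≡ v
grdDesc-units v = trans (+-identityʳ _) (n/1≡n v)

orderly-units : Orderly (1 ∷ [])
orderly-units = forms⇒orderly forms (here refl)
  where
  forms : GreedyForms (1 ∷ [])
  forms = record
    { Form = ℕ ; value = λ v → v ; cost = λ v → v ; empty = 0 ; value-empty = refl ; cost-empty = refl
    ; grd-value = grdDesc-units
    ; add-coin = λ { v (here refl) → suc v , refl , ≤-refl } }

orderly-1∷c : ∀ c → 0 < c → Orderly (1 ∷ c ∷ [])
orderly-1∷c c@(suc u) 0<c = forms⇒orderly forms (here refl)
  where
  Form = ℕ × Σ ℕ (_< c)
  value cost : Form → ℕ
  value (q , y , _) = y + q * c
  cost  (q , y , _) = q + y

  grd-value : ∀ f → grd (1 ∷ c ∷ []) (value f) ≡ cost f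
  grd-value (q , y , y<c) = trans (grdDesc-+* c (1 ∷ []) q y<c) (cong (q +_) (grdDesc-units y))

  add-1 : ∀ f → Attains value cost (1 + value f) (suc (cost f))
  add-1 (q , y , y<c) with m<1+n⇒m<n∨m≡n y<c
  ... | inj₁ y<u  = (q , suc y , s≤s y<u) , refl , ≤-reflexive (+-suc q y)
  ... | inj₂ refl = (suc q , 0 , 0<c) , refl , s≤s (≤-trans (≤-reflexive (+-identityʳ q)) (m≤m+n q y))

  add-c : ∀ f → Attains value cost (c + value f) (suc (cost f))
  add-c (q , y , y<c) = (suc q , y , y<c) , x∙yz≈y∙xz y c (q * c) , ≤-refl

  forms : GreedyForms (1 ∷ c ∷ [])
  forms = record
    { Form = Form ; value = value ; cost = cost ; empty = 0 , 0 , 0<c ; value-empty = refl ; cost-empty = refl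
    ; grd-value = grd-value
    ; add-coin = λ { f (here refl) → add-1 f ; f (there (here refl)) → add-c f } }

module SmallCoins (u : ℕ) (1≤u : 1 ≤ u) where

  a b : ℕ
  a = suc u
  b = suc (u + u)

  u<b : u < b
  u<b = s≤s (m≤m+n u u)

  data Low : Set where
    units   : (y : ℕ) → y < a → Low
    a+units : (z : ℕ) → z < u → Low

  lowValue lowCost : Low → ℕ
  lowValue (units y _)   = y
  lowValue (a+units z _) = z + a
  lowCost (units y _)   = y
  lowCost (a+units z _) = suc z

  lowValue<b : ∀ l → lowValue l < b
  lowValue<b (units y y<a)   = ≤-trans y<a u<b
  lowValue<b (a+units z z<u) = s≤s (subst (_≤ u + u) (sym (+-suc z u)) (+-monoˡ-≤ u z<u))

  grdDesc-low : ∀ l → grdDesc (a ∷ 1 ∷ []) (lowValue l) ≡ lowCost l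
  grdDesc-low (units y y<a)   = trans (grdDesc-below a (1 ∷ []) y<a) (grdDesc-units y)
  grdDesc-low (a+units z z<u) = begin
    grdDesc (a ∷ 1 ∷ []) (z + a)     ≡⟨ cong (λ w → grdDesc (a ∷ 1 ∷ []) (z + w)) (*-identityˡ a) ⟨
    grdDesc (a ∷ 1 ∷ []) (z + 1 * a) ≡⟨ grdDesc-+* a (1 ∷ []) 1 (m<n⇒m<1+n z<u) ⟩
    suc (grdDesc (1 ∷ []) z)         ≡⟨ cong suc (grdDesc-units z) ⟩
    suc z ∎
    where open ≡-Reasoning

  grdDesc-low+b* : ∀ l e → grdDesc (b ∷ a ∷ 1 ∷ []) (lowValue l + e * b) ≡ e + lowCost l
  grdDesc-low+b* l e = trans (grdDesc-+* b (a ∷ 1 ∷ []) e (lowValue<b l)) (cong (e +_) (grdDesc-low l))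

  low-suc : ∀ l → (Σ Low λ l′ → lowValue l′ ≡ suc (lowValue l) × lowCost l′ ≤ suc (lowCost l))
                ⊎ suc (lowValue l) ≡ b
  low-suc (units y y<a) with m<1+n⇒m<n∨m≡n y<a
  ... | inj₁ y<u  = inj₁ (units (suc y) (s≤s y<u) , refl , ≤-refl)
  ... | inj₂ refl = inj₁ (a+units 0 1≤u , refl , s≤s z≤n)
  low-suc (a+units z z<u) with m≤n⇒m<n∨m≡n z<u
  ... | inj₁ 1+z<u = inj₁ (a+units (suc z) 1+z<u , refl , ≤-refl)
  ... | inj₂ refl  = inj₂ (cong suc (+-suc z (suc z)))

  low+a : ∀ l → (Σ ℕ λ z → z < u × lowValue l ≡ z × lowCost l ≡ z)
              ⊎ (Σ Low λ l′ → a + lowValue l ≡ b + lowValue l′ × lowCost l′ ≤ lowCost l)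
  low+a (units y y<a) with m<1+n⇒m<n∨m≡n y<a
  ... | inj₁ y<u  = inj₁ (y , y<u , refl , refl)
  ... | inj₂ refl = inj₂ (units 0 (s≤s z≤n) , cong suc (sym (+-identityʳ (u + u))) , z≤n)
  low+a (a+units z z<u) = inj₂ (units (suc z) (s≤s z<u) , a+[z+a]≡b+[1+z] u z , ≤-refl)
    where
    a+[z+a]≡b+[1+z] : ∀ u z → suc u + (z + suc u) ≡ suc (u + u) + suc z
    a+[z+a]≡b+[1+z] = solve-∀

  orderly-1∷a∷b : Orderly (1 ∷ a ∷ b ∷ [])
  orderly-1∷a∷b = forms⇒orderly forms (here refl)
    where
    Form = ℕ × Low
    value cost : Form → ℕ
    value (q , l) = lowValue l + q * b
    cost  (q , l) = q + lowCost l

    add-1 : ∀ f → Attains value cost (1 + value f) (suc (cost f))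
    add-1 (q , l) with low-suc l
    ... | inj₁ (l′ , value≡ , cost≤) =
      (q , l′) , cong (_+ q * b) value≡ , ≤-trans (+-monoʳ-≤ q cost≤) (≤-reflexive (+-suc q _))
    ... | inj₂ carry =
      (suc q , units 0 (s≤s z≤n)) , cong (_+ q * b) (sym carry) , s≤s (≤-trans (≤-reflexive (+-identityʳ q)) (m≤m+n q _))

    add-a : ∀ f → Attains value cost (a + value f) (suc (cost f))
    add-a (q , l) with low+a l
    ... | inj₁ (z , z<u , value≡ , cost≡) =
      (q , a+units z z<u) , trans (+-assoc z a (q * b)) (trans (x∙yz≈y∙xz z a (q * b)) (cong (λ w → a + (w + q * b)) (sym value≡))) ,
      ≤-reflexive (trans (+-suc q z) (cong (λ w → suc (q + w)) (sym cost≡)))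
    ... | inj₂ (l′ , a+value≡ , cost≤) =
      (suc q , l′) ,
      trans (x∙yz≈y∙xz (lowValue l′) b (q * b))
        (trans (sym (+-assoc b _ (q * b))) (trans (cong (_+ q * b) (sym a+value≡)) (+-assoc a _ (q * b)))) ,
      s≤s (+-monoʳ-≤ q cost≤)

    add-b : ∀ f → Attains value cost (b + value f) (suc (cost f))
    add-b (q , l) = (suc q , l) , x∙yz≈y∙xz (lowValue l) b (q * b) , ≤-refl

    forms : GreedyForms (1 ∷ a ∷ b ∷ [])
    forms = record
      { Form = Form ; value = value ; cost = cost ; empty = 0 , units 0 (s≤s z≤n) ; value-empty = refl ; cost-empty = refl
      ; grd-value = λ (q , l) → grdDesc-low+b* l q
      ; add-coin = λ { f (here refl) → add-1 f ; f (there (here refl)) → add-a f ; f (there (there (here refl))) → add-b f } }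

eStep-odd : ∀ r m a {k p} → k ≤ 2 * r + 1 → k % 2 ≡ 1 → eStep r m a k p ≡ p + (a ∸ 1)
eStep-odd r m a {k} k≤ odd with k ≤? 2 * r + 1 | k % 2 ≟ 1
... | yes _ | yes _   = refl
... | yes _ | no ¬odd = contradiction odd ¬odd
... | no k≰ | _       = contradiction k≤ k≰

eStep-even : ∀ r m a {k p} → k ≤ 2 * r + 1 → k % 2 ≡ 0 →
  eStep r m a k p ≡ p + (m ∸ 1) * (2 * a ∸ 1) ∸ (a ∸ 1)
eStep-even r m a {k} k≤ even with k ≤? 2 * r + 1 | k % 2 ≟ 1
... | yes _ | yes odd = contradiction (trans (sym even) odd) λ ()
... | yes _ | no _    = refl
... | no k≰ | _       = contradiction k≤ k≰

eStep-late : ∀ r m a {k p} → 2 * r + 1 < k → eStep r m a k p ≡ p + (m ∸ 1) * (2 * a ∸ 1)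
eStep-late r m a {k} k> with k ≤? 2 * r + 1
... | yes k≤ = contradiction k≤ (<⇒≱ k>)
... | no _   = refl

eStep-increasing : ∀ r m a → 0 < a ∸ 1 → a ∸ 1 < (m ∸ 1) * (2 * a ∸ 1) → ∀ k p → p < eStep r m a k p
eStep-increasing r m a 0<u u<X k p with k ≤? 2 * r + 1 | k % 2 ≟ 1
... | yes _ | yes _ = m<m+n p 0<u
... | yes _ | no _  = subst (p <_) (sym (+-∸-assoc p (<⇒≤ u<X))) (m<m+n p (m<n⇒0<n∸m u<X))
... | no _  | _     = m<m+n p (<-trans 0<u u<X)

[j+j]%2≡0 : ∀ j → (j + j) % 2 ≡ 0
[j+j]%2≡0 j = trans (cong (_% 2) (j+j≡j*2 j)) (m*n%n≡0 j 2)
  where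
  j+j≡j*2 : ∀ j → j + j ≡ j * 2
  j+j≡j*2 = solve-∀

[1+j+j]%2≡1 : ∀ j → suc (j + j) % 2 ≡ 1
[1+j+j]%2≡1 j = trans (cong (_% 2) (1+j+j≡1+j*2 j)) ([m+kn]%n≡m%n 1 j 2)
  where
  1+j+j≡1+j*2 : ∀ j → suc (j + j) ≡ 1 + j * 2
  1+j+j≡1+j*2 = solve-∀

even⊎odd : ∀ i → (Σ ℕ λ j → i ≡ j + j) ⊎ (Σ ℕ λ j → i ≡ suc (j + j))
even⊎odd zero = inj₁ (0 , refl)
even⊎odd (suc i) with even⊎odd i
... | inj₁ (j , i≡) = inj₂ (j , cong suc i≡)
... | inj₂ (j , i≡) = inj₁ (suc j , cong suc (trans i≡ (sym (+-suc j j))))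

half-≤ : ∀ j n → j + j ≤ suc (n + n) → j ≤ n
half-≤ zero    n       _ = z≤n
half-≤ (suc j) zero    (s≤s j+1+j≤0) = contradiction (subst (_≤ 0) (+-suc j j) j+1+j≤0) λ ()
half-≤ (suc j) (suc n) le =
  s≤s (half-≤ j n (≤-pred (≤-pred (subst₂ _≤_ (cong suc (+-suc j j)) (cong (suc ∘′ suc) (+-suc n n)) le))))

+-suc-≤ : ∀ q {c c′} → c ≤ c′ → q + suc c ≤ suc (q + c′)
+-suc-≤ q {c′ = c′} c≤c′ = ≤-trans (+-monoʳ-≤ q (s≤s c≤c′)) (≤-reflexive (+-suc q c′))

x+w+c+t≡c+[x+w+t] : ∀ x w c t → x + w + c + t ≡ c + (x + w + t)
x+w+c+t≡c+[x+w+t] = solve-∀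

-- Here r = R + 1, m = s + 1, a = u + 1, and E k = eₖ: e₂ⱼ₊₂ = P j,
-- e₂ⱼ₊₃ = B j, e₂ᵣ₊₁₊ₜ = B (R + t), and the last coin e₃ᵣ = E (suc N) is T.
module Construction (R′ s′ u : ℕ) (2+s′≤u : 2 + s′ ≤ u) where

  1≤u : 1 ≤ u
  1≤u = ≤-trans (s≤s z≤n) 2+s′≤u

  open SmallCoins u 1≤u public

  R s r m X : ℕ
  R = suc R′
  s = suc s′
  r = suc R
  m = suc s
  X = s * b

  P B : ℕ → ℕ
  P j = j * X + a
  B k = k * X + b

  T N : ℕ
  T = B (R + R)
  N = 3 + R′ + (R + R)

  E : ℕ → ℕ
  E = eE r m a

  3r≡1+N : 3 * r ≡ suc N
  3r≡1+N = lemma R′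
    where
    lemma : ∀ R′ → 3 * suc (suc R′) ≡ 4 + (R′ + (suc R′ + suc R′))
    lemma = solve-∀

  2r+1≡3+R+R : 2 * r + 1 ≡ 3 + (R + R)
  2r+1≡3+R+R = lemma R
    where
    lemma : ∀ R → 2 * suc R + 1 ≡ 3 + (R + R)
    lemma = solve-∀

  2a∸1≡b : 2 * a ∸ 1 ≡ b
  2a∸1≡b = lemma u
    where
    lemma : ∀ u → u + 1 * suc u ≡ suc (u + u)
    lemma = solve-∀

  u<X : u < X
  u<X = <-≤-trans u<b (m≤m+n b (s′ * b))

  e-P : ∀ j → j ≤ R → E (2 + (j + j)) ≡ P j
  e-B : ∀ j → j ≤ R → E (3 + (j + j)) ≡ B j
  e-P zero    _     = refl
  e-P (suc j) 1+j≤R = begin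
    E (2 + (suc j + suc j))                         ≡⟨ cong (λ i → E (3 + i)) (+-suc j j) ⟩
    eStep r m a (4 + (j + j)) (E (3 + (j + j)))     ≡⟨ eStep-even r m a index≤ (trans (cong (_% 2) (index≡ j)) ([j+j]%2≡0 (2 + j))) ⟩
    E (3 + (j + j)) + s * (2 * a ∸ 1) ∸ u           ≡⟨ cong₂ (λ c d → c + s * d ∸ u) (e-B j (<⇒≤ 1+j≤R)) 2a∸1≡b ⟩
    B j + X ∸ u                                     ≡⟨ cong (_∸ u) (B+X≡P+u j X u) ⟩
    P (suc j) + u ∸ u                               ≡⟨ m+n∸n≡m (P (suc j)) u ⟩
    P (suc j) ∎
    where
    open ≡-Reasoning
    index≤ : 4 + (j + j) ≤ 2 * r + 1
    index≤ = subst (4 + (j + j) ≤_) (sym 2r+1≡3+R+R)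
      (s≤s (s≤s (s≤s (subst (_≤ R + R) (+-suc j j) (+-mono-≤ (<⇒≤ 1+j≤R) 1+j≤R)))))
    index≡ : ∀ j → 4 + (j + j) ≡ (2 + j) + (2 + j)
    index≡ = solve-∀
    B+X≡P+u : ∀ j X u → j * X + suc (u + u) + X ≡ (1 + j) * X + suc u + u
    B+X≡P+u = solve-∀
  e-B j j≤R = begin
    eStep r m a (3 + (j + j)) (E (2 + (j + j)))  ≡⟨ eStep-odd r m a index≤ odd ⟩
    E (2 + (j + j)) + u                          ≡⟨ cong (_+ u) (e-P j j≤R) ⟩
    j * X + a + u                                ≡⟨ +-assoc (j * X) a u ⟩
    B j ∎
    where
    open ≡-Reasoning
    index≤ : 3 + (j + j) ≤ 2 * r + 1
    index≤ = subst (3 + (j + j) ≤_) (sym 2r+1≡3+R+R) (s≤s (s≤s (s≤s (+-mono-≤ j≤R j≤R))))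
    odd : (3 + (j + j)) % 2 ≡ 1
    odd = trans (cong (λ i → suc (suc i) % 2) (sym (+-suc j j))) ([1+j+j]%2≡1 (suc j))

  B+X≡B : ∀ k → B k + X ≡ B (suc k)
  B+X≡B k = lemma k X b
    where
    lemma : ∀ k X b → k * X + b + X ≡ suc k * X + b
    lemma = solve-∀

  e-late : ∀ t → E (3 + (t + (R + R))) ≡ B (t + R)
  e-late zero    = e-B R ≤-refl
  e-late (suc t) = begin
    eStep r m a (4 + (t + (R + R))) (E (3 + (t + (R + R))))  ≡⟨ eStep-late r m a index> ⟩
    E (3 + (t + (R + R))) + s * (2 * a ∸ 1)                  ≡⟨ cong₂ (λ c d → c + s * d) (e-late t) 2a∸1≡b ⟩
    B (t + R) + X                                            ≡⟨ B+X≡B (t + R) ⟩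
    B (suc t + R) ∎
    where
    open ≡-Reasoning
    index> : 2 * r + 1 < 4 + (t + (R + R))
    index> = subst (_< 4 + (t + (R + R))) (sym 2r+1≡3+R+R) (s≤s (s≤s (s≤s (s≤s (m≤n+m (R + R) t)))))

  E-< : ∀ n → E (suc n) < E (2 + n)
  E-< zero    = s≤s 1≤u
  E-< (suc n) = eStep-increasing r m a 1≤u (subst (λ d → u < s * d) (sym 2a∸1≡b) u<X) (3 + n) (E (2 + n))

  E-mono-≤ : ∀ {j n} → j ≤ n → E (suc j) ≤ E (suc n)
  E-mono-≤ {n = zero}  z≤n = ≤-refl
  E-mono-≤ {n = suc n} j≤1+n with m≤n⇒m<n∨m≡n j≤1+n
  ... | inj₂ refl      = ≤-refl
  ... | inj₁ (s≤s j≤n) = ≤-trans (E-mono-≤ j≤n) (<⇒≤ (E-< n))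

  E-mono-< : ∀ {j n} → j < n → E (suc j) < E (suc n)
  E-mono-< {j} j<n = <-≤-trans (E-< j) (E-mono-≤ j<n)

  e-N : E (suc N) ≡ T
  e-N = e-late (suc R′)

  desc : ℕ → List ℕ
  desc = applyDownFrom (E ∘′ suc)

  grdDesc-desc-below : ∀ {j n w} → j ≤ n → w < E (suc j) → grdDesc (desc n) w ≡ grdDesc (desc j) w
  grdDesc-desc-below {n = zero}  z≤n   _ = refl
  grdDesc-desc-below {j} {suc n} {w} j≤1+n w< with m≤n⇒m<n∨m≡n j≤1+n
  ... | inj₂ refl      = refl
  ... | inj₁ (s≤s j≤n) = trans (grdDesc-below (E (suc n)) (desc n) (<-≤-trans w< (E-mono-≤ j≤n))) (grdDesc-desc-below j≤n w<)

  grdDesc-desc3 : ∀ l e → grdDesc (desc 3) (lowValue l + e * b) ≡ e + lowCost l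
  grdDesc-desc3 l e = trans (cong (λ c → grdDesc (c ∷ a ∷ 1 ∷ []) (lowValue l + e * b)) (e-B 0 z≤n)) (grdDesc-low+b* l e)

  low+e*b<X : ∀ l {e} → e < s → lowValue l + e * b < X
  low+e*b<X l {e} e<s = <-≤-trans (+-monoˡ-< (e * b) (lowValue<b l)) (*-monoˡ-≤ b e<s)

  -- The part lowValue l + e * b left after B k must stay below the gap to the
  -- next coin: X when R ≤ k, but only P (suc k) ∸ B k = s′ * b + a when k < R.
  Fits : ℕ → ℕ → Low → Set
  Fits k e (units _ _)   = ⊤
  Fits k e (a+units _ _) = R ≤ k ⊎ suc e < s

  fits-0 : ∀ {e} l → suc e < s → Fits 0 e l
  fits-0 (units _ _)   _     = tt
  fits-0 (a+units _ _) 1+e<s = inj₂ 1+e<s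

  fits-bound : ∀ {k e} l → k < R → e < s → Fits k e l → lowValue l + e * b < s′ * b + a
  fits-bound {e = e} (units y y<a) _ e<s _ =
    subst (y + e * b <_) (+-comm a (s′ * b)) (+-mono-<-≤ y<a (*-monoˡ-≤ b (≤-pred e<s)))
  fits-bound (a+units z z<u) k<R _ (inj₁ R≤k)   = contradiction R≤k (<⇒≱ k<R)
  fits-bound {e = e} (a+units z z<u) _ _ (inj₂ 1+e<s) =
    ≤-trans (<-≤-trans (+-monoˡ-< (e * b) (lowValue<b (a+units z z<u))) (*-monoˡ-≤ b (≤-pred 1+e<s))) (m≤m+n (s′ * b) a)

  B+s′b+a≡P : ∀ k → B k + s′ * b + a ≡ P (suc k)
  B+s′b+a≡P k = lemma k u s′
    where
    lemma : ∀ k u s′ → let b = suc (u + u) ; X = suc s′ * b in k * X + b + s′ * b + suc u ≡ suc k * X + suc u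
    lemma = solve-∀

  record BIndex (k : ℕ) : Set where
    field
      index      : ℕ
      e-index    : E (suc index) ≡ B k
      below-next : ∀ {e} l → e < s → Fits k e l → lowValue l + e * b + B k < E (2 + index)
      index<N    : index < N
      index-0    : k ≡ 0 → index ≡ 2
      3≤index    : 1 ≤ k → 3 ≤ index

  bIndex-early : ∀ k → k < R → BIndex k
  bIndex-early k k<R = record
    { index      = 2 + (k + k)
    ; e-index    = e-B k (<⇒≤ k<R)
    ; below-next = λ {e} l e<s fits → begin-strict
        lowValue l + e * b + B k   ≡⟨ +-comm _ (B k) ⟩
        B k + (lowValue l + e * b) <⟨ +-monoʳ-< (B k) (fits-bound l k<R e<s fits) ⟩
        B k + (s′ * b + a)         ≡⟨ +-assoc (B k) _ a ⟨
        B k + s′ * b + a           ≡⟨ B+s′b+a≡P k ⟩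
        P (suc k)                  ≡⟨ e-P (suc k) k<R ⟨
        E (2 + (suc k + suc k))    ≡⟨ cong (λ i → E (3 + i)) (+-suc k k) ⟩
        E (4 + (k + k)) ∎
    ; index<N    = s≤s (s≤s (s≤s (≤-trans (+-mono-≤ (<⇒≤ k<R) (<⇒≤ k<R)) (m≤n+m (R + R) R′))))
    ; index-0    = λ { refl → refl }
    ; 3≤index    = λ 1≤k → s≤s (s≤s (≤-trans 1≤k (m≤m+n k k)))
    }
    where open ≤-Reasoning

  bIndex-late : ∀ t → t + R < R + R → BIndex (t + R)
  bIndex-late t t+R<R+R = record
    { index      = 2 + (t + (R + R))
    ; e-index    = e-late t
    ; below-next = λ {e} l e<s _ → begin-strict
        lowValue l + e * b + B (t + R)   ≡⟨ +-comm _ (B (t + R)) ⟩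
        B (t + R) + (lowValue l + e * b) <⟨ +-monoʳ-< (B (t + R)) (low+e*b<X l e<s) ⟩
        B (t + R) + X                    ≡⟨ B+X≡B (t + R) ⟩
        B (suc t + R)                    ≡⟨ e-late (suc t) ⟨
        E (4 + (t + (R + R))) ∎
    ; index<N    = s≤s (s≤s (s≤s (+-monoˡ-≤ (R + R) (≤-pred (+-cancelʳ-< R t R t+R<R+R)))))
    ; index-0    = λ t+R≡0 → contradiction (trans (sym (+-suc t R′)) t+R≡0) λ ()
    ; 3≤index    = λ _ → s≤s (s≤s (≤-trans (s≤s z≤n) (m≤n+m (R + R) t)))
    }
    where open ≤-Reasoning

  bIndex : ∀ k → k < R + R → BIndex k
  bIndex k k<R+R with k <? R
  ... | yes k<R = bIndex-early k k<R
  ... | no  k≮R = subst BIndex k∸R+R≡k (bIndex-late (k ∸ R) (subst (_< R + R) (sym k∸R+R≡k) k<R+R))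
    where
    k∸R+R≡k : k ∸ R + R ≡ k
    k∸R+R≡k = m∸n+n≡m (≮⇒≥ k≮R)

  data Residue : Set where
    low  : Low → Residue
    topP : (j z : ℕ) → j ≤ R → z < u → Residue
    topB : (k e : ℕ) (l : Low) → k < R + R → e < s → Fits k e l → Residue

  rvalue rcost : Residue → ℕ
  rvalue (low l)            = lowValue l
  rvalue (topP j z _ _)     = z + P j
  rvalue (topB k e l _ _ _) = lowValue l + e * b + B k
  rcost (low l)            = lowCost l
  rcost (topP j z _ _)     = suc z
  rcost (topB k e l _ _ _) = suc (e + lowCost l)

  u+P≡B : ∀ j → u + P j ≡ B j
  u+P≡B j = lemma j u s′
    where
    lemma : ∀ j u s′ → let b = suc (u + u) ; X = suc s′ * b in u + (j * X + suc u) ≡ j * X + b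
    lemma = solve-∀

  X≤B : ∀ {k} → 1 ≤ k → X ≤ B k
  X≤B {suc k} _ = ≤-trans (m≤m+n X (k * X)) (m≤m+n (X + k * X) b)

  below-index : ∀ {index w} → index < N → w < E (2 + index) →
    w < T × grdDesc (desc N) w ≡ grdDesc (E (suc index) ∷ desc index) w
  below-index {index} index<N w< =
    <-≤-trans w< (subst (E (2 + index) ≤_) e-N (E-mono-≤ index<N)) , grdDesc-desc-below index<N w<

  grdDesc-topP : ∀ j z → z < u → grdDesc (P j ∷ desc (suc (j + j))) (z + P j) ≡ suc z
  grdDesc-topP j z z<u = begin
    grdDesc (P j ∷ desc index) (z + P j)      ≡⟨ cong (λ w → grdDesc (P j ∷ desc index) (z + w)) (*-identityˡ (P j)) ⟨
    grdDesc (P j ∷ desc index) (z + 1 * P j)  ≡⟨ grdDesc-+* (P j) (desc index) 1 (≤-trans (m<n⇒m<1+n z<u) (m≤n+m a (j * X))) ⟩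
    suc (grdDesc (desc index) z)              ≡⟨ cong suc (grdDesc-desc-below {j = 1} {n = index} (s≤s z≤n) (m<n⇒m<1+n z<u)) ⟩
    suc (grdDesc (1 ∷ []) z)                  ≡⟨ cong suc (grdDesc-units z) ⟩
    suc z ∎
    where
    open ≡-Reasoning
    index = suc (j + j)

  grdDesc-topB : ∀ {k} e l → e < s → (I : BIndex k) →
    grdDesc (B k ∷ desc (BIndex.index I)) (lowValue l + e * b + B k) ≡ suc (e + lowCost l)
  grdDesc-topB {zero} e l _ I rewrite BIndex.index-0 I refl =
    trans (cong (grdDesc (b ∷ a ∷ 1 ∷ [])) (trans (+-assoc (lowValue l) (e * b) b) (cong (lowValue l +_) (+-comm (e * b) b))))
          (grdDesc-low+b* l (suc e))
  grdDesc-topB {k@(suc _)} e l e<s I = begin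
    grdDesc (B k ∷ desc index) (w + B k)      ≡⟨ cong (λ v → grdDesc (B k ∷ desc index) (w + v)) (*-identityˡ (B k)) ⟨
    grdDesc (B k ∷ desc index) (w + 1 * B k)  ≡⟨ grdDesc-+* (B k) (desc index) 1 w<B ⟩
    suc (grdDesc (desc index) w)              ≡⟨ cong suc (grdDesc-desc-below {j = 3} {n = index} (3≤index (s≤s z≤n)) w<E4) ⟩
    suc (grdDesc (desc 3) w)                  ≡⟨ cong suc (grdDesc-desc3 l e) ⟩
    suc (e + lowCost l) ∎
    where
    open ≡-Reasoning
    open BIndex I
    w = lowValue l + e * b
    w<B : w < B k
    w<B = <-≤-trans (low+e*b<X l e<s) (X≤B {k} (s≤s z≤n))
    w<E4 : w < E 4
    w<E4 = subst (w <_) (sym (e-P 1 (s≤s z≤n))) (<-≤-trans (low+e*b<X l e<s) (≤-trans (m≤m+n X 0) (m≤m+n (X + 0) a)))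

  grd-residue : ∀ ρ → rvalue ρ < T × grdDesc (desc N) (rvalue ρ) ≡ rcost ρ
  grd-residue (low l) = proj₁ bound , trans (proj₂ bound) (grdDesc-low l)
    where
    bound = below-index {1} (s≤s (s≤s z≤n)) (subst (lowValue l <_) (sym (e-B 0 z≤n)) (lowValue<b l))
  grd-residue (topP j z j≤R z<u) =
    proj₁ bound ,
    trans (proj₂ bound) (trans (cong (λ c → grdDesc (c ∷ desc (suc (j + j))) (z + P j)) (e-P j j≤R)) (grdDesc-topP j z z<u))
    where
    index<N : suc (suc (j + j)) ≤ N
    index<N = s≤s (s≤s (≤-trans (+-mono-≤ j≤R j≤R) (≤-trans (m≤n+m (R + R) R′) (n≤1+n _))))
    bound = below-index index<N (subst (z + P j <_) (trans (u+P≡B j) (sym (e-B j j≤R))) (+-monoˡ-< (P j) z<u))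
  grd-residue (topB k e l k<R+R e<s fits) =
    proj₁ bound ,
    trans (proj₂ bound) (trans (cong (λ c → grdDesc (c ∷ desc index) (lowValue l + e * b + B k)) e-index) (grdDesc-topB e l e<s I))
    where
    I = bIndex k k<R+R
    open BIndex I
    bound = below-index index<N (below-next l e<s fits)

  Form : Set
  Form = ℕ × Residue

  value cost : Form → ℕ
  value (q , ρ) = rvalue ρ + q * T
  cost  (q , ρ) = q + rcost ρ

  reverse-coinE : reverse (coinE r m a) ≡ T ∷ desc N
  reverse-coinE = trans (reverse-applyUpTo (E ∘′ suc) (3 * r)) (trans (cong desc 3r≡1+N) (cong (_∷ desc N) e-N))

  grd-value : ∀ f → grd (coinE r m a) (value f) ≡ cost f
  grd-value (q , ρ) = begin
    grd (coinE r m a) (rvalue ρ + q * T)    ≡⟨ cong (λ cs → grdDesc cs (rvalue ρ + q * T)) reverse-coinE ⟩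
    grdDesc (T ∷ desc N) (rvalue ρ + q * T) ≡⟨ grdDesc-+* T (desc N) q (proj₁ (grd-residue ρ)) ⟩
    q + grdDesc (desc N) (rvalue ρ)         ≡⟨ cong (q +_) (proj₂ (grd-residue ρ)) ⟩
    q + rcost ρ ∎
    where open ≡-Reasoning

  Attainable : ℕ → ℕ → Set
  Attainable = Attains value cost

  form : ∀ q ρ → Attainable (rvalue ρ + q * T) (q + rcost ρ)
  form q ρ = (q , ρ) , refl , ≤-refl

  0<s : 0 < s
  0<s = s≤s z≤n

  attains-B< : ∀ q k e l → k < R + R → e < s →
    Attainable (lowValue l + e * b + B k + q * T) (q + suc (e + lowCost l))
  attains-B< q k e l@(units _ _)     k<R+R e<s = form q (topB k e l k<R+R e<s tt)
  attains-B< q k e l@(a+units z z<u) k<R+R e<s with R ≤? k | m<1+n⇒m<n∨m≡n e<s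
  ... | yes R≤k | _          = form q (topB k e l k<R+R e<s (inj₁ R≤k))
  ... | no _    | inj₁ e<s′  = form q (topB k e l k<R+R e<s (inj₂ (s≤s e<s′)))
  ... | no R≰k  | inj₂ refl  =
    attains-cast (lemma z k u s′ (q * T)) (+-monoʳ-≤ q (≤-trans (m≤n+m (suc z) e) (n≤1+n _)))
      (form q (topP (suc k) z (≰⇒> R≰k) z<u))
    where
      lemma : ∀ z k u s′ t → let b = suc (u + u) ; X = suc s′ * b in
        z + (suc k * X + suc u) + t ≡ z + suc u + s′ * b + (k * X + b) + t
      lemma = solve-∀

  attains-T : ∀ q e l → e < s → Attainable (lowValue l + e * b + T + q * T) (q + suc (e + lowCost l))
  attains-T q zero     l _   =
    attains-cast (lemma (lowValue l) b T q) (≤-reflexive (sym (+-suc q (lowCost l)))) (form (suc q) (low l))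
    where
    lemma : ∀ y b T q → y + suc q * T ≡ y + 0 * b + T + q * T
    lemma = solve-∀
  attains-T q (suc e) l 1+e<s =
    attains-cast (lemma (lowValue l) e b T q) (≤-reflexive (sym (+-suc q _)))
      (form (suc q) (topB 0 e l (s≤s z≤n) (m<n⇒m<1+n (≤-pred 1+e<s) ) (fits-0 l 1+e<s)))
    where
    lemma : ∀ y e b T q → y + e * b + b + suc q * T ≡ y + suc e * b + T + q * T
    lemma = solve-∀

  attains-B : ∀ q k e l → k ≤ R + R → e < s →
    Attainable (lowValue l + e * b + B k + q * T) (q + suc (e + lowCost l))
  attains-B q k e l k≤R+R e<s with m≤n⇒m<n∨m≡n k≤R+R
  ... | inj₁ k<R+R = attains-B< q k e l k<R+R e<s
  ... | inj₂ refl  = attains-T q e l e<s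

  attains-B≤s : ∀ q k e l → k ≤ R + R → e ≤ s →
    Attainable (lowValue l + e * b + B k + q * T) (q + suc (e + lowCost l))
  attains-B≤s q k e l k≤R+R e≤s with m≤n⇒m<n∨m≡n e≤s
  ... | inj₁ e<s  = attains-B q k e l k≤R+R e<s
  ... | inj₂ refl with m≤n⇒m<n∨m≡n k≤R+R
  ...   | inj₁ k<R+R = attains-cast (lemma (lowValue l) k u s′ (q * T)) (+-monoʳ-≤ q (s≤s (m≤n+m (lowCost l) s)))
                         (attains-B q (suc k) 0 l k<R+R 0<s)
    where
    lemma : ∀ y k u s′ t → let b = suc (u + u) ; X = suc s′ * b in
      y + 0 * b + (suc k * X + b) + t ≡ y + suc s′ * b + (k * X + b) + t
    lemma = solve-∀
  ...   | inj₂ refl = attains-cast (lemma (lowValue l) s′ b T q) (≤-reflexive (sym (+-suc q _)))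
                        (attains-B (suc q) 0 s′ l z≤n ≤-refl)
    where
    lemma : ∀ y e b T q → y + e * b + b + suc q * T ≡ y + suc e * b + T + q * T
    lemma = solve-∀

  B+B≡T+B : ∀ {i j k} → R + R + i ≡ j + k → B j + B k ≡ T + B i
  B+B≡T+B {i} {j} {k} R+R+i≡j+k = begin
    B j + B k                      ≡⟨ lemma j k X b ⟩
    (j + k) * X + b + b            ≡⟨ cong (λ n → n * X + b + b) R+R+i≡j+k ⟨
    (R + R + i) * X + b + b        ≡⟨ lemma′ (R + R) i X b ⟩
    T + B i ∎
    where
    open ≡-Reasoning
    lemma : ∀ j k X b → j * X + b + (k * X + b) ≡ (j + k) * X + b + b
    lemma = solve-∀
    lemma′ : ∀ n i X b → (n + i) * X + b + b ≡ n * X + b + (i * X + b)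
    lemma′ = solve-∀

  B+P≡T+P : ∀ {i j k} → R + R + i ≡ k + j → B k + P j ≡ T + P i
  B+P≡T+P {i} {j} {k} R+R+i≡k+j = begin
    B k + P j                      ≡⟨ lemma k j X b a ⟩
    (k + j) * X + b + a            ≡⟨ cong (λ n → n * X + b + a) R+R+i≡k+j ⟨
    (R + R + i) * X + b + a        ≡⟨ lemma′ (R + R) i X b a ⟩
    T + P i ∎
    where
    open ≡-Reasoning
    lemma : ∀ k j X b a → k * X + b + (j * X + a) ≡ (k + j) * X + b + a
    lemma = solve-∀
    lemma′ : ∀ n i X b a → (n + i) * X + b + a ≡ n * X + b + (i * X + a)
    lemma′ = solve-∀

  attains-BB : ∀ q j k e l → j ≤ R + R → k ≤ R + R → e < s →
    Attainable (lowValue l + e * b + B j + B k + q * T) (q + suc (suc (e + lowCost l)))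
  attains-BB q j k e l j≤R+R k≤R+R e<s with j + k <? R + R
  ... | yes j+k<R+R =
    attains-cast (lemma (lowValue l) e j k X b (q * T)) ≤-refl (attains-B≤s q (j + k) (suc e) l (<⇒≤ j+k<R+R) e<s)
    where
    lemma : ∀ y e j k X b t → y + suc e * b + ((j + k) * X + b) + t ≡ y + e * b + (j * X + b) + (k * X + b) + t
    lemma = solve-∀
  ... | no j+k≮R+R = attains-cast value≡ (≤-reflexive (sym (+-suc q _))) (attains-B (suc q) i e l i≤R+R e<s)
    where
    i = j + k ∸ (R + R)
    i≤R+R : i ≤ R + R
    i≤R+R = ≤-trans (∸-monoˡ-≤ (R + R) (+-mono-≤ j≤R+R k≤R+R)) (≤-reflexive (m+n∸n≡m (R + R) (R + R)))
    B+B≡ : B j + B k ≡ T + B i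
    B+B≡ = B+B≡T+B {i} {j} {k} (m+[n∸m]≡n (≮⇒≥ j+k≮R+R))
    value≡ : lowValue l + e * b + B i + suc q * T ≡ lowValue l + e * b + B j + B k + q * T
    value≡ = begin
      lowValue l + e * b + B i + suc q * T       ≡⟨ lemma (lowValue l + e * b) (B i) T q ⟩
      lowValue l + e * b + (T + B i) + q * T     ≡⟨ cong (λ v → lowValue l + e * b + v + q * T) B+B≡ ⟨
      lowValue l + e * b + (B j + B k) + q * T   ≡⟨ cong (_+ q * T) (+-assoc (lowValue l + e * b) (B j) (B k)) ⟨
      lowValue l + e * b + B j + B k + q * T ∎
      where
      open ≡-Reasoning
      lemma : ∀ x c T q → x + c + suc q * T ≡ x + (T + c) + q * T
      lemma = solve-∀

  attains-BP : ∀ q k j e z → k ≤ R + R → j ≤ R → e < s → z < u →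
    Attainable (z + e * b + B k + P j + q * T) (q + suc (suc (e + z)))
  attains-BP q k j e z k≤R+R j≤R e<s z<u with k + j ≤? R + R
  ... | yes k+j≤R+R =
    attains-cast (lemma z e k j u s′ (q * T)) (≤-reflexive (cong (λ c → q + suc c) (+-suc e z)))
      (attains-B q (k + j) e (a+units z z<u) k+j≤R+R e<s)
    where
    lemma : ∀ z e k j u s′ t → let b = suc (u + u) ; X = suc s′ * b in
      z + suc u + e * b + ((k + j) * X + b) + t ≡ z + e * b + (k * X + b) + (j * X + suc u) + t
    lemma = solve-∀
  ... | no k+j≰R+R = overflow e e<s
    where
    i = k + j ∸ (R + R)
    i≤R : i ≤ R
    i≤R = ≤-trans (∸-monoˡ-≤ (R + R) (+-mono-≤ k≤R+R j≤R)) (≤-reflexive (m+n∸m≡n (R + R) R))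
    B+P≡ : B k + P j ≡ T + P i
    B+P≡ = B+P≡T+P {i} {j} {k} (m+[n∸m]≡n (<⇒≤ (≰⇒> k+j≰R+R)))
    value≡ : ∀ w → z + w + P i + suc q * T ≡ z + w + B k + P j + q * T
    value≡ w = begin
      z + w + P i + suc q * T       ≡⟨ lemma (z + w) (P i) T q ⟩
      z + w + (T + P i) + q * T     ≡⟨ cong (λ v → z + w + v + q * T) B+P≡ ⟨
      z + w + (B k + P j) + q * T   ≡⟨ cong (_+ q * T) (+-assoc (z + w) (B k) (P j)) ⟨
      z + w + B k + P j + q * T ∎
      where
      open ≡-Reasoning
      lemma : ∀ x c T q → x + c + suc q * T ≡ x + (T + c) + q * T
      lemma = solve-∀
    overflow : ∀ e → e < s → Attainable (z + e * b + B k + P j + q * T) (q + suc (suc (e + z)))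
    overflow zero    _     = attains-cast (trans (cong (_+ suc q * T) (cong (_+ P i) (sym (+-identityʳ z)))) (value≡ 0))
                               (≤-reflexive (sym (+-suc q (suc z)))) (form (suc q) (topP i z i≤R z<u))
    overflow (suc e) 1+e<s = attains-cast (trans (lemma z e i u s′ (suc q * T)) (value≡ (suc e * b))) (≤-reflexive (cost≡ q e z))
                               (attains-B (suc q) i e (a+units z z<u) (≤-trans i≤R (m≤m+n R R)) (m<n⇒m<1+n (≤-pred 1+e<s)))
      where
      lemma : ∀ z e i u s′ t → let b = suc (u + u) ; X = suc s′ * b in
        z + suc u + e * b + (i * X + b) + t ≡ z + suc e * b + (i * X + suc u) + t
      lemma = solve-∀
      cost≡ : ∀ q e z → suc q + suc (e + suc z) ≡ q + suc (suc (suc e + z))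
      cost≡ = solve-∀

  P+low≡B+low : ∀ j {l l′} → a + lowValue l ≡ b + lowValue l′ → P j + lowValue l ≡ B j + lowValue l′
  P+low≡B+low j {l} {l′} a+l≡b+l′ = begin
    j * X + a + lowValue l     ≡⟨ +-assoc (j * X) a (lowValue l) ⟩
    j * X + (a + lowValue l)   ≡⟨ cong (j * X +_) a+l≡b+l′ ⟩
    j * X + (b + lowValue l′)  ≡⟨ +-assoc (j * X) b (lowValue l′) ⟨
    B j + lowValue l′ ∎
    where open ≡-Reasoning

  add-1 : ∀ f → Attainable (1 + value f) (suc (cost f))
  add-1 (q , low l) with low-suc l
  ... | inj₁ (l′ , value≡ , cost≤) =
    attains-cast (cong (_+ q * T) value≡) (≤-trans (+-monoʳ-≤ q cost≤) (≤-reflexive (+-suc q _))) (form q (low l′))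
  ... | inj₂ carry = attains-cast (cong (_+ q * T) (sym carry)) (+-suc-≤ q z≤n) (attains-B q 0 0 (units 0 (s≤s z≤n)) z≤n 0<s)
  add-1 (q , topP j z j≤R z<u) with m≤n⇒m<n∨m≡n z<u
  ... | inj₁ 1+z<u = attains-cast refl (≤-reflexive (+-suc q (suc z))) (form q (topP j (suc z) j≤R 1+z<u))
  ... | inj₂ refl  = attains-cast (cong (_+ q * T) (sym (u+P≡B j))) (+-suc-≤ q z≤n)
                       (attains-B q j 0 (units 0 (s≤s z≤n)) (≤-trans j≤R (m≤m+n R R)) 0<s)
  add-1 (q , topB k e l k<R+R e<s _) with low-suc l
  ... | inj₁ (l′ , value≡ , cost≤) =
    attains-cast (cong (λ v → v + e * b + B k + q * T) value≡)
      (+-suc-≤ q (≤-trans (+-monoʳ-≤ e cost≤) (≤-reflexive (+-suc e _))))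
      (attains-B q k e l′ (<⇒≤ k<R+R) e<s)
  ... | inj₂ carry =
    attains-cast (cong (λ v → v + e * b + B k + q * T) (sym carry)) (+-suc-≤ q (s≤s (+-monoʳ-≤ e z≤n)))
      (attains-B≤s q k (suc e) (units 0 (s≤s z≤n)) (<⇒≤ k<R+R) e<s)

  add-B : ∀ k → k ≤ R + R → ∀ f → Attainable (B k + value f) (suc (cost f))
  add-B k k≤R+R (q , low l) =
    attains-cast (trans (x+w+c+t≡c+[x+w+t] (lowValue l) 0 (B k) (q * T)) (cong (λ v → B k + (v + q * T)) (+-identityʳ _)))
      (+-suc-≤ q ≤-refl) (attains-B q k 0 l k≤R+R 0<s)
  add-B k k≤R+R (q , topP j z j≤R z<u) =
    attains-cast (lemma z (B k) (P j) (q * T)) (+-suc-≤ q ≤-refl) (attains-BP q k j 0 z k≤R+R j≤R 0<s z<u)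
    where
    lemma : ∀ z c p t → z + 0 + c + p + t ≡ c + (z + p + t)
    lemma = solve-∀
  add-B k k≤R+R (q , topB k′ e l k′<R+R e<s _) =
    attains-cast (x+w+c+t≡c+[x+w+t] (lowValue l + e * b) (B k′) (B k) (q * T)) (+-suc-≤ q ≤-refl)
      (attains-BB q k′ k e l (<⇒≤ k′<R+R) k≤R+R e<s)

  add-P-topB : ∀ j → j ≤ R → ∀ q k e l → k < R + R → e < s →
    Attainable (P j + (lowValue l + e * b + B k + q * T)) (suc (q + suc (e + lowCost l)))
  add-P-topB j j≤R q k e l k<R+R e<s with low+a l
  ... | inj₁ (z , z<u , value≡ , cost≡) =
    attains-cast (trans (x+w+c+t≡c+[x+w+t] (z + e * b) (B k) (P j) (q * T))
                        (cong (λ v → P j + (v + e * b + B k + q * T)) (sym value≡)))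
      (+-suc-≤ q (s≤s (+-monoʳ-≤ e (≤-reflexive (sym cost≡))))) (attains-BP q k j e z (<⇒≤ k<R+R) j≤R e<s z<u)
  ... | inj₂ (l′ , a+l≡b+l′ , cost≤) =
    attains-cast value≡ (+-suc-≤ q (s≤s (+-monoʳ-≤ e cost≤)))
      (attains-BB q k j e l′ (<⇒≤ k<R+R) (≤-trans j≤R (m≤m+n R R)) e<s)
    where
    w = e * b + B k + q * T
    value≡ : lowValue l′ + e * b + B k + B j + q * T ≡ P j + (lowValue l + e * b + B k + q * T)
    value≡ = begin
      lowValue l′ + e * b + B k + B j + q * T  ≡⟨ lemma (lowValue l′) (e * b) (B k) (B j) (q * T) ⟩
      B j + lowValue l′ + w                    ≡⟨ cong (_+ w) (P+low≡B+low j {l} {l′} a+l≡b+l′) ⟨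
      P j + lowValue l + w                     ≡⟨ lemma′ (P j) (lowValue l) (e * b) (B k) (q * T) ⟩
      P j + (lowValue l + e * b + B k + q * T) ∎
      where
      open ≡-Reasoning
      lemma : ∀ y x c d t → y + x + c + d + t ≡ d + y + (x + c + t)
      lemma = solve-∀
      lemma′ : ∀ p y x c t → p + y + (x + c + t) ≡ p + (y + x + c + t)
      lemma′ = solve-∀

  add-P : ∀ j → j ≤ R → ∀ f → Attainable (P j + value f) (suc (cost f))
  add-P j j≤R (q , low l) with low+a l
  ... | inj₁ (z , z<u , value≡ , cost≡) =
    attains-cast (trans (+-assoc z (P j) (q * T)) (trans (x∙yz≈y∙xz z (P j) (q * T)) (cong (λ v → P j + (v + q * T)) (sym value≡))))
      (+-suc-≤ q (≤-reflexive (sym cost≡))) (form q (topP j z j≤R z<u))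
  ... | inj₂ (l′ , a+l≡b+l′ , cost≤) =
    attains-cast value≡ (+-suc-≤ q cost≤) (attains-B q j 0 l′ (≤-trans j≤R (m≤m+n R R)) 0<s)
    where
    value≡ : lowValue l′ + 0 * b + B j + q * T ≡ P j + (lowValue l + q * T)
    value≡ = begin
      lowValue l′ + 0 + B j + q * T  ≡⟨ lemma (lowValue l′) (B j) (q * T) ⟩
      B j + lowValue l′ + q * T      ≡⟨ cong (_+ q * T) (P+low≡B+low j {l} {l′} a+l≡b+l′) ⟨
      P j + lowValue l + q * T       ≡⟨ +-assoc (P j) (lowValue l) (q * T) ⟩
      P j + (lowValue l + q * T) ∎
      where
      open ≡-Reasoning
      lemma : ∀ y c t → y + 0 + c + t ≡ c + y + t
      lemma = solve-∀
  add-P j j≤R (q , topP i z i≤R z<u) =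
    attains-cast (lemma z i j u s′ (q * T)) (+-suc-≤ q ≤-refl)
      (attains-B q (i + j) 0 (units (suc z) (s≤s z<u)) (+-mono-≤ i≤R j≤R) 0<s)
    where
    lemma : ∀ z i j u s′ t → let b = suc (u + u) ; X = suc s′ * b in
      suc z + 0 * b + ((i + j) * X + b) + t ≡ (j * X + suc u) + (z + (i * X + suc u) + t)
    lemma = solve-∀
  add-P j j≤R (q , topB k e l k<R+R e<s _) = add-P-topB j j≤R q k e l k<R+R e<s

  data CoinIndex (i : ℕ) : Set where
    unit : i ≡ 0 → CoinIndex i
    P-at : ∀ j → j ≤ R → i ≡ suc (j + j) → CoinIndex i
    B-at : ∀ k → k ≤ R + R → E (suc i) ≡ B k → (∀ {j} → j ≤ R → j ≤ k → suc (j + j) < i) → CoinIndex i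

  coin-index : ∀ i → i ≤ N → CoinIndex i
  coin-index i i≤N with i ≤? 2 + (R + R)
  coin-index zero    _ | yes _ = unit refl
  coin-index (suc i) _ | yes 1+i≤ with even⊎odd i
  ... | inj₁ (j , refl) = P-at j (half-≤ j R (≤-pred 1+i≤)) refl
  ... | inj₂ (j , refl) = B-at j (≤-trans j≤R (m≤m+n R R)) (e-B j j≤R) λ _ j′≤j → s≤s (s≤s (+-mono-≤ j′≤j j′≤j))
    where
    j≤R : j ≤ R
    j≤R = half-≤ j R (≤-trans (≤-pred (≤-pred 1+i≤)) (n≤1+n _))
  coin-index i i≤N | no i≰ = subst CoinIndex i≡ (B-at (t + R) (+-monoˡ-≤ R t≤R) (e-late t) earlier)
    where
    t = i ∸ (2 + (R + R))
    i≡ : 2 + (t + (R + R)) ≡ i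
    i≡ = trans (cong (2 +_) (+-comm t (R + R))) (m+[n∸m]≡n (<⇒≤ (≰⇒> i≰)))
    t≤R : t ≤ R
    t≤R = +-cancelʳ-≤ (R + R) t R (≤-pred (≤-pred (subst (_≤ N) (sym i≡) i≤N)))
    earlier : ∀ {j} → j ≤ R → j ≤ t + R → suc (j + j) < 2 + (t + (R + R))
    earlier j≤R _ = s≤s (s≤s (≤-trans (+-mono-≤ j≤R j≤R) (m≤n+m (R + R) t)))

  add-coin : ∀ f {c} → c ∈ coinE r m a → Attainable (c + value f) (suc (cost f))
  add-coin f c∈ with ∈-applyUpTo⁻ (E ∘′ suc) c∈
  ... | i , i<3r , refl with coin-index i (≤-pred (subst (i <_) 3r≡1+N i<3r))
  ... | unit refl            = add-1 f
  ... | P-at j j≤R refl      = subst (λ c → Attainable (c + value f) (suc (cost f))) (sym (e-P j j≤R)) (add-P j j≤R f)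
  ... | B-at k k≤R+R e≡B _   = subst (λ c → Attainable (c + value f) (suc (cost f))) (sym e≡B) (add-B k k≤R+R f)

  orderly-E : Orderly (coinE r m a)
  orderly-E = forms⇒orderly forms (subst (λ n → 1 ∈ applyUpTo (E ∘′ suc) n) (sym 3r≡1+N) (here refl))
    where
    forms : GreedyForms (coinE r m a)
    forms = record
      { Form = Form ; value = value ; cost = cost ; empty = 0 , low (units 0 (s≤s z≤n)) ; value-empty = refl ; cost-empty = refl
      ; grd-value = grd-value ; add-coin = add-coin }

  grd-prefix : ∀ i v → grd (applyUpTo (E ∘′ suc) i) v ≡ grdDesc (desc i) v
  grd-prefix i v = cong (λ cs → grdDesc cs v) (reverse-applyUpTo (E ∘′ suc) i)

  B-cancel-< : ∀ {j k} → B j < B k → j < k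
  B-cancel-< {j} {k} Bj<Bk = *-cancelʳ-< X j k (+-cancelʳ-< b (j * X) (k * X) Bj<Bk)

  -- B (suc j) = B j + s b, but greedy on it takes P (suc j) and then u ones.
  ¬orderly-P : ∀ j → suc j ≤ R → ¬ Orderly (applyUpTo (E ∘′ suc) (2 + (suc j + suc j)))
  ¬orderly-P j 1+j≤R = shorter⇒¬orderly 0<B (B j ∷ replicate s b) coins sum≡ shorter
    where
    k = suc j
    n = suc (k + k)
    cs = applyUpTo (E ∘′ suc) (suc n)
    0<B : 0 < B k
    0<B = ≤-trans (s≤s z≤n) (m≤n+m b (k * X))
    coins : All (_∈ cs) (B j ∷ replicate s b)
    coins = subst (_∈ cs) (e-B j (<⇒≤ 1+j≤R)) (∈-applyUpTo⁺ (E ∘′ suc) (s≤s (s≤s (s≤s (+-monoʳ-≤ j (n≤1+n j))))))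
          ∷ replicate⁺ s (subst (_∈ cs) (e-B 0 z≤n) (∈-applyUpTo⁺ (E ∘′ suc) (s≤s (s≤s (s≤s z≤n)))))
    sum≡ : sum (B j ∷ replicate s b) ≡ B k
    sum≡ = trans (cong (B j +_) (sum-replicate s b)) (B+X≡B j)
    grd≡ : grd cs (B k) ≡ suc u
    grd≡ = begin
      grd cs (B k)                       ≡⟨ grd-prefix (suc n) (B k) ⟩
      grdDesc (E (suc n) ∷ desc n) (B k) ≡⟨ cong (λ c → grdDesc (c ∷ desc n) (B k)) (e-P k 1+j≤R) ⟩
      grdDesc (P k ∷ desc n) (B k)       ≡⟨ cong (grdDesc (P k ∷ desc n)) (sym (u+P≡B k)) ⟩
      grdDesc (P k ∷ desc n) (u + P k)   ≡⟨ cong (λ w → grdDesc (P k ∷ desc n) (u + w)) (*-identityˡ (P k)) ⟨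
      grdDesc (P k ∷ desc n) (u + 1 * P k) ≡⟨ grdDesc-+* (P k) (desc n) 1 (≤-trans ≤-refl (m≤n+m a (k * X))) ⟩
      suc (grdDesc (desc n) u)           ≡⟨ cong suc (grdDesc-desc-below {j = 1} {n = n} (s≤s z≤n) ≤-refl) ⟩
      suc (grdDesc (1 ∷ []) u)           ≡⟨ cong suc (grdDesc-units u) ⟩
      suc u ∎
      where open ≡-Reasoning
    shorter : length (B j ∷ replicate s b) < grd cs (B k)
    shorter = subst₂ _<_ (cong suc (sym (length-replicate s))) (sym grd≡) (s≤s 2+s′≤u)

  P+P≡1+X+B : ∀ {j₁ j₂ k} → j₁ + j₂ ≡ suc k → P j₁ + (P j₂ + 0) ≡ suc X + 1 * B k
  P+P≡1+X+B {j₁} {j₂} {k} j₁+j₂≡1+k = begin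
    P j₁ + (P j₂ + 0)        ≡⟨ lemma j₁ j₂ X a ⟩
    (j₁ + j₂) * X + a + a    ≡⟨ cong (λ n → n * X + a + a) j₁+j₂≡1+k ⟩
    suc k * X + a + a        ≡⟨ lemma′ k u s′ ⟩
    suc X + 1 * B k ∎
    where
    open ≡-Reasoning
    lemma : ∀ j₁ j₂ X a → j₁ * X + a + (j₂ * X + a + 0) ≡ (j₁ + j₂) * X + a + a
    lemma = solve-∀
    lemma′ : ∀ k u s′ → let b = suc (u + u) ; X = suc s′ * b in
      suc k * X + suc u + suc u ≡ suc X + 1 * (k * X + b)
    lemma′ = solve-∀

  grdDesc-1+X+B : ∀ {k i} → 1 ≤ k → 3 ≤ i → grdDesc (B k ∷ desc i) (suc X + 1 * B k) ≡ suc (s + 1)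
  grdDesc-1+X+B {k@(suc k′)} {i} _ 3≤i = begin
    grdDesc (B k ∷ desc i) (suc X + 1 * B k)  ≡⟨ grdDesc-+* (B k) (desc i) 1 1+X<B ⟩
    suc (grdDesc (desc i) (suc X))            ≡⟨ cong suc (grdDesc-desc-below {j = 3} 3≤i 1+X<E4) ⟩
    suc (grdDesc (desc 3) (suc X))            ≡⟨ cong suc (grdDesc-desc3 (units 1 (s≤s 1≤u)) s) ⟩
    suc (s + 1) ∎
    where
    open ≡-Reasoning
    2≤b : 2 ≤ b
    2≤b = s≤s (≤-trans 1≤u (m≤m+n u u))
    1+X<B : suc X < B k
    1+X<B = ≤-trans (≤-reflexive (+-comm 2 X)) (≤-trans (+-monoʳ-≤ X 2≤b) (+-monoˡ-≤ b (m≤m+n X (k′ * X))))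
    1+X<E4 : suc X < E 4
    1+X<E4 = subst (suc X <_) (sym (e-P 1 (s≤s z≤n)))
      (≤-trans (≤-reflexive (+-comm 2 X)) (+-mono-≤ (≤-reflexive (sym (+-identityʳ X))) (s≤s 1≤u)))

  -- P ⌊(k+1)/2⌋ + P ⌈(k+1)/2⌉ = B k + s b + 1, which greedy pays with 2 + s coins.
  ¬orderly-B : ∀ k i → 1 ≤ k → k < R + R → E (suc i) ≡ B k → 3 ≤ i →
    (∀ {j} → j ≤ R → j ≤ k → suc (j + j) < i) → ¬ Orderly (applyUpTo (E ∘′ suc) (suc i))
  ¬orderly-B k@(suc k′) i _ k<R+R e≡B 3≤i earlier = shorter⇒¬orderly 0<v (P j₁ ∷ P j₂ ∷ []) coins refl shorter
    where
    cs = applyUpTo (E ∘′ suc) (suc i)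
    j₁ = ⌊ suc k /2⌋
    j₂ = ⌈ suc k /2⌉
    v = P j₁ + (P j₂ + 0)
    j₂≤k : j₂ ≤ k
    j₂≤k = ≤-pred (⌈n/2⌉<n k′)
    j₂≤R : j₂ ≤ R
    j₂≤R = subst (j₂ ≤_) (sym (n≡⌈n+n/2⌉ R)) (⌈n/2⌉-mono k<R+R)
    j₁≤j₂ : j₁ ≤ j₂
    j₁≤j₂ = ⌊n/2⌋≤⌈n/2⌉ (suc k)
    0<v : 0 < v
    0<v = ≤-trans (s≤s z≤n) (≤-trans (m≤n+m a (j₁ * X)) (m≤m+n (P j₁) _))
    P∈ : ∀ {j} → j ≤ R → j ≤ k → P j ∈ cs
    P∈ {j} j≤R j≤k = subst (_∈ cs) (e-P j j≤R) (∈-applyUpTo⁺ (E ∘′ suc) (m<n⇒m<1+n (earlier j≤R j≤k)))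
    coins : All (_∈ cs) (P j₁ ∷ P j₂ ∷ [])
    coins = P∈ (≤-trans j₁≤j₂ j₂≤R) (≤-trans j₁≤j₂ j₂≤k) ∷ P∈ j₂≤R j₂≤k ∷ []
    v≡ : v ≡ suc X + 1 * B k
    v≡ = P+P≡1+X+B {j₁} {j₂} (⌊n/2⌋+⌈n/2⌉≡n (suc k))
    grd≡ : grd cs v ≡ suc (s + 1)
    grd≡ = begin
      grd cs v                                  ≡⟨ grd-prefix (suc i) v ⟩
      grdDesc (E (suc i) ∷ desc i) v            ≡⟨ cong₂ (λ c w → grdDesc (c ∷ desc i) w) e≡B v≡ ⟩
      grdDesc (B k ∷ desc i) (suc X + 1 * B k)  ≡⟨ grdDesc-1+X+B {k} (s≤s z≤n) 3≤i ⟩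
      suc (s + 1) ∎
      where open ≡-Reasoning
    shorter : 2 < grd cs v
    shorter = subst (2 <_) (sym grd≡) (s≤s (s≤s (m≤n+m 1 s′)))

  ¬orderly-prefix : ∀ i → 3 ≤ i → i < N → ¬ Orderly (applyUpTo (E ∘′ suc) (suc i))
  ¬orderly-prefix i 3≤i i<N with coin-index i (<⇒≤ i<N)
  ... | unit refl               = contradiction 3≤i λ ()
  ... | P-at zero _ refl        = contradiction 3≤i λ { (s≤s ()) }
  ... | P-at (suc j) 1+j≤R refl = ¬orderly-P j 1+j≤R
  ... | B-at k _ e≡B earlier    = ¬orderly-B k i 1≤k k<R+R e≡B 3≤i earlier
    where
    1≤k : 1 ≤ k
    1≤k = B-cancel-< (subst₂ _<_ (e-B 0 z≤n) e≡B (E-mono-< 3≤i))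
    k<R+R : k < R + R
    k<R+R = B-cancel-< (subst₂ _<_ e≡B e-N (E-mono-< i<N))

  prefix≡ : ∀ {i} → i ≤ 3 * r → prefix (coinE r m a) i ≡ applyUpTo (E ∘′ suc) i
  prefix≡ = take-applyUpTo (E ∘′ suc)

  orderly-prefix3 : Orderly (prefix (coinE r m a) 3)
  orderly-prefix3 = subst Orderly (sym (trans (prefix≡ 3≤3r) (cong (λ c → 1 ∷ a ∷ c ∷ []) (e-B 0 z≤n)))) orderly-1∷a∷b
    where
    3≤3r : 3 ≤ 3 * r
    3≤3r = subst (3 ≤_) (sym 3r≡1+N) (s≤s (s≤s (s≤s z≤n)))

  ¬orderly-prefixes : ∀ i → 4 ≤ i → i ≤ 3 * r ∸ 1 → ¬ Orderly (prefix (coinE r m a) i)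
  ¬orderly-prefixes (suc i) (s≤s 3≤i) 1+i≤ =
    subst (¬_ ∘′ Orderly) (sym (prefix≡ (≤-trans 1+i≤ (m∸n≤m (3 * r) 1))))
      (¬orderly-prefix i 3≤i (subst (suc i ≤_) (cong (_∸ 1) 3r≡1+N) 1+i≤))

theorem4p5 : (r m a : ℕ) → 2 ≤ r → 1 < m → m < a →
    Orderly (prefix (coinE r m a) 1)
    × Orderly (prefix (coinE r m a) 2)
    × Orderly (prefix (coinE r m a) 3)
    × ((i : ℕ) → 4 ≤ i → i ≤ 3 * r ∸ 1 → ¬ Orderly (prefix (coinE r m a) i))
    × Orderly (coinE r m a)
theorem4p5 .(2 + R′) .(2 + s′) .(suc u) (s≤s (s≤s {n = R′} z≤n)) (s≤s (s≤s {n = s′} z≤n)) (s≤s {n = u} 2+s′≤u) =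
  orderly-units , orderly-1∷c a (s≤s z≤n) , orderly-prefix3 , ¬orderly-prefixes , orderly-E
  where open Construction R′ s′ u 2+s′≤u
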